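{- Fix $n\ge1$. For all relatively prime nonzero integers $a,b,c$ with $a+b+c=0$, $$h_{\mathcal O(1,1,\dots,1)}(P^*_{a,b,c})\le 4h([a:b:c])+O(1),$$ with $O(1)$ independent of $a,b,c$.
   Context: $h$ is the standard logarithmic height on $\mathbb P^2(\mathbb Q)$, $h([a:b:c])=\log\max\{|a|,|b|,|c|\}$ for coprime integers, and $h_{\mathcal O(1,\dots,1)}$ is the height on $(\mathbb P^2)^{n+1}$ for the line sheaf of multidegree $(1,\dots,1)$ (sum of the heights of the factors), defined up to $O(1)$. For relatively prime nonzero $a,b,c$ with $a+b+c=0$, choose integers $x_1,\dots,x_n$ with $x_1x_2^2\cdots x_n^n=a$ and, for every prime $p$, $\operatorname{ord}_p(x_n)=\lfloor\operatorname{ord}_p(a)/n\rfloor$ and, for $1\le i<n$, $\operatorname{ord}_p(x_i)=1$ if $i=\operatorname{ord}_p(a)-n\lfloor\operatorname{ord}_p(a)/n\rfloor$ and $0$ otherwise; choose $y_i,z_i$ similarly for $b,c$. Then $P^*_{a,b,c}=([a:b:c],[x_1:y_1:z_1],\dots,[x_n:y_n:z_n])\in(\mathbb P^2)^{n+1}(\mathbb Q)$. -}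

module Defs where

open import Data.Nat as ℕ using (ℕ; zero; suc; _⊔_; NonZero)
open import Data.Nat.Divisibility using (_∣_)
open import Data.Nat.GCD using (gcd)
open import Data.Nat.DivMod using (_/_; _%_)
open import Data.Nat.Primality using (Prime)
open import Data.Integer as ℤ using (ℤ; ∣_∣)
import Data.Fin
import Data.Bool
open import Data.Fin using (Fin; toℕ)
open import Data.Product using (_×_)
open import Relation.Nullary using (¬_)
open import Relation.Binary.PropositionalEquality using (_≡_)

-- Multiplicative height of [a:b:c] ∈ P²(ℚ) given by an integer triple
-- (not all zero): max(|a|,|b|,|c|) / gcd(a,b,c).  Defined as 0 when all are 0
-- (never used).  The logarithmic height is h = log H.
H : ℤ → ℤ → ℤ → ℕ
H a b c with gcd ∣ a ∣ (gcd ∣ b ∣ ∣ c ∣)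
... | zero  = 0
... | suc g = (∣ a ∣ ⊔ ∣ b ∣ ⊔ ∣ c ∣) / suc g

RelPrime : ℤ → ℤ → ℤ → Set
RelPrime a b c = gcd ∣ a ∣ (gcd ∣ b ∣ ∣ c ∣) ≡ 1

Ord : ℕ → ℕ → ℕ → Set
Ord p m k = (p ℕ.^ k ∣ m) × ¬ (p ℕ.^ suc k ∣ m)

-- x₁ x₂² ⋯ xₙⁿ, where x : Fin n → ℤ and index i stands for x_{toℕ i + 1}
weightedProd : (n : ℕ) → (Fin n → ℤ) → ℤ
weightedProd zero    x = ℤ.+ 1
weightedProd (suc n) x = weightedProd n (λ i → x (Data.Fin.inject₁ i))
                         ℤ.* (x (Data.Fin.fromℕ n) ℤ.^ suc n)

-- The prescribed valuation of x_j (j = 1..n) when ord_p(a) = k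
targetOrd : (n : ℕ) → .{{NonZero n}} → ℕ → ℕ → ℕ
targetOrd n j k with j ℕ.≡ᵇ n
... | Data.Bool.true  = k / n
... | Data.Bool.false with j ℕ.≡ᵇ (k % n)
...   | Data.Bool.true  = 1
...   | Data.Bool.false = 0

Admissible : (n : ℕ) → .{{NonZero n}} → ℤ → (Fin n → ℤ) → Set
Admissible n a x =
  (weightedProd n x ≡ a) ×
  ((p : ℕ) → Prime p → (k : ℕ) → Ord p ∣ a ∣ k →
     (i : Fin n) → Ord p ∣ x i ∣ (targetOrd n (suc (toℕ i)) k))

prodH : (n : ℕ) → (Fin n → ℤ) → (Fin n → ℤ) → (Fin n → ℤ) → ℕ
prodH zero    x y z = 1
prodH (suc n) x y z =
  prodH n (λ i → x (Data.Fin.inject₁ i)) (λ i → y (Data.Fin.inject₁ i)) (λ i → z (Data.Fin.inject₁ i))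
  ℕ.* H (x (Data.Fin.fromℕ n)) (y (Data.Fin.fromℕ n)) (z (Data.Fin.fromℕ n))

{-# OPTIONS --safe #-}
-- Each factor is bounded by a trivial estimate: for nonzero integers,
-- H(xᵢ,yᵢ,zᵢ) ≤ max ∣·∣ ≤ ∣xᵢ yᵢ zᵢ∣ ≤ ∣xᵢ∣ⁱ ∣yᵢ∣ⁱ ∣zᵢ∣ⁱ, so the product of the
-- factor heights is at most ∣abc∣ ≤ max(∣a∣,∣b∣,∣c∣)³, and coprimality makes
-- that maximum equal to H(a,b,c).
module Submission where

open import Defs
open import Data.Nat using (ℕ; _≤_; _*_; _^_; NonZero)
open import Data.Integer using (ℤ; _+_; 0ℤ)
open import Data.Fin using (Fin)
open import Data.Product using (∃)
open import Relation.Nullary using (¬_)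
open import Relation.Binary.PropositionalEquality using (_≡_)

open import Data.Nat using (zero; suc; _⊔_; z≤n)
open import Data.Nat.Properties
  using ( ≤-refl; ≤-trans; ≤-reflexive; module ≤-Reasoning; *-mono-≤; *-monoʳ-≤
        ; *-assoc; *-identityˡ; *-identityʳ; m≤m*n; m≤n*m; m*n≢0; m*n≢0⇒m≢0; m*n≢0⇒n≢0
        ; m^n≢0; ⊔-lub; ⊔-monoˡ-≤; m≤m⊔n; m≤n⊔m; *-commutativeSemigroup )
open import Data.Nat.GCD using (gcd)
open import Data.Nat.DivMod using (m/n≤m; n/1≡n)
open import Data.Integer as ℤ using (∣_∣)
open import Data.Integer.Properties using (abs-*)
open import Data.Fin using (inject₁; fromℕ)
open import Data.Product using (_,_)
open import Function using (_∘_)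
open import Relation.Binary.PropositionalEquality using (refl; sym; trans; cong; cong₂)
open import Algebra.Properties.CommutativeSemigroup *-commutativeSemigroup using (interchange)

∣i^n∣≡∣i∣^n : ∀ i n → ∣ i ℤ.^ n ∣ ≡ ∣ i ∣ ^ n
∣i^n∣≡∣i∣^n i zero    = refl
∣i^n∣≡∣i∣^n i (suc n) = trans (abs-* i (i ℤ.^ n)) (cong (∣ i ∣ *_) (∣i^n∣≡∣i∣^n i n))

i*j≢0⇒i≢0 : ∀ i {j} → .{{ℤ.NonZero (i ℤ.* j)}} → ℤ.NonZero i
i*j≢0⇒i≢0 i {j} rewrite abs-* i j = m*n≢0⇒m≢0 (∣ i ∣)

i*j≢0⇒j≢0 : ∀ i {j} → .{{ℤ.NonZero (i ℤ.* j)}} → ℤ.NonZero j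
i*j≢0⇒j≢0 i {j} rewrite abs-* i j = m*n≢0⇒n≢0 (∣ i ∣)

m≤m^n : ∀ m n .{{_ : NonZero m}} .{{_ : NonZero n}} → m ≤ m ^ n
m≤m^n m (suc n) = m≤m*n m (m ^ n) {{m^n≢0 m n}}

m⊔n≤m*n : ∀ m n .{{_ : NonZero m}} .{{_ : NonZero n}} → m ⊔ n ≤ m * n
m⊔n≤m*n m n = ⊔-lub (m≤m*n m n) (m≤n*m n m)

m⊔n⊔o≤m*n*o : ∀ m n o .{{_ : NonZero m}} .{{_ : NonZero n}} .{{_ : NonZero o}} →
              m ⊔ n ⊔ o ≤ m * n * o
m⊔n⊔o≤m*n*o m n o = ≤-trans (⊔-monoˡ-≤ o (m⊔n≤m*n m n)) (m⊔n≤m*n (m * n) o {{m*n≢0 m n}})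

m*n*o≤[m⊔n⊔o]^3 : ∀ m n o → m * n * o ≤ (m ⊔ n ⊔ o) ^ 3
m*n*o≤[m⊔n⊔o]^3 m n o = ≤-trans (*-mono-≤ (*-mono-≤ m≤M n≤M) o≤M) (≤-reflexive M*M*M≡M^3)
  where
  M = m ⊔ n ⊔ o
  m≤M : m ≤ M
  m≤M = ≤-trans (m≤m⊔n m n) (m≤m⊔n (m ⊔ n) o)
  n≤M : n ≤ M
  n≤M = ≤-trans (m≤n⊔m m n) (m≤m⊔n (m ⊔ n) o)
  o≤M : o ≤ M
  o≤M = m≤n⊔m (m ⊔ n) o
  M*M*M≡M^3 : M * M * M ≡ M ^ 3
  M*M*M≡M^3 = trans (*-assoc M M M) (cong (λ t → M * (M * t)) (sym (*-identityʳ M)))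

H≤∣a∣⊔∣b∣⊔∣c∣ : ∀ a b c → H a b c ≤ ∣ a ∣ ⊔ ∣ b ∣ ⊔ ∣ c ∣
H≤∣a∣⊔∣b∣⊔∣c∣ a b c with gcd ∣ a ∣ (gcd ∣ b ∣ ∣ c ∣)
... | zero  = z≤n
... | suc g = m/n≤m _ (suc g)

RelPrime⇒H≡∣a∣⊔∣b∣⊔∣c∣ : ∀ {a b c} → RelPrime a b c → H a b c ≡ ∣ a ∣ ⊔ ∣ b ∣ ⊔ ∣ c ∣
RelPrime⇒H≡∣a∣⊔∣b∣⊔∣c∣ {a} {b} {c} coprime with gcd ∣ a ∣ (gcd ∣ b ∣ ∣ c ∣)
RelPrime⇒H≡∣a∣⊔∣b∣⊔∣c∣ refl | .1 = n/1≡n _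

H≤∣a∣^k*∣b∣^k*∣c∣^k : ∀ k a b c →
                       .{{_ : ℤ.NonZero a}} .{{_ : ℤ.NonZero b}} .{{_ : ℤ.NonZero c}} .{{_ : NonZero k}} →
                       H a b c ≤ ∣ a ∣ ^ k * ∣ b ∣ ^ k * ∣ c ∣ ^ k
H≤∣a∣^k*∣b∣^k*∣c∣^k k a b c = begin
  H a b c                         ≤⟨ H≤∣a∣⊔∣b∣⊔∣c∣ a b c ⟩
  ∣ a ∣ ⊔ ∣ b ∣ ⊔ ∣ c ∣           ≤⟨ m⊔n⊔o≤m*n*o (∣ a ∣) (∣ b ∣) (∣ c ∣) ⟩
  ∣ a ∣ * ∣ b ∣ * ∣ c ∣           ≤⟨ *-mono-≤ (*-mono-≤ (m≤m^n (∣ a ∣) k) (m≤m^n (∣ b ∣) k)) (m≤m^n (∣ c ∣) k) ⟩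
  ∣ a ∣ ^ k * ∣ b ∣ ^ k * ∣ c ∣ ^ k ∎
  where open ≤-Reasoning

∣weightedProd-suc∣ : ∀ n (x : Fin (suc n) → ℤ) →
  ∣ weightedProd (suc n) x ∣ ≡ ∣ weightedProd n (x ∘ inject₁) ∣ * ∣ x (fromℕ n) ∣ ^ suc n
∣weightedProd-suc∣ n x =
  trans (abs-* (weightedProd n (x ∘ inject₁)) _)
        (cong (∣ weightedProd n (x ∘ inject₁) ∣ *_) (∣i^n∣≡∣i∣^n (x (fromℕ n)) (suc n)))

module _ {n} (x : Fin (suc n) → ℤ) .{{_ : ℤ.NonZero (weightedProd (suc n) x)}} where

  weightedProd-init-nonZero : ℤ.NonZero (weightedProd n (x ∘ inject₁))
  weightedProd-init-nonZero = i*j≢0⇒i≢0 (weightedProd n (x ∘ inject₁))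

  weightedProd-last-nonZero : ℤ.NonZero (x (fromℕ n))
  weightedProd-last-nonZero =
    i*j≢0⇒i≢0 (x (fromℕ n)) {{i*j≢0⇒j≢0 (weightedProd n (x ∘ inject₁))}}

prodH≤∣weightedProd∣³ : ∀ n (x y z : Fin n → ℤ) →
  .{{_ : ℤ.NonZero (weightedProd n x)}} → .{{_ : ℤ.NonZero (weightedProd n y)}} →
  .{{_ : ℤ.NonZero (weightedProd n z)}} →
  prodH n x y z ≤ ∣ weightedProd n x ∣ * ∣ weightedProd n y ∣ * ∣ weightedProd n z ∣
prodH≤∣weightedProd∣³ zero    x y z = ≤-refl
prodH≤∣weightedProd∣³ (suc n) x y z = begin
  prodH n x′ y′ z′ * H xₙ yₙ zₙ
    ≤⟨ *-mono-≤ init-bound last-bound ⟩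
  (∣ X′ ∣ * ∣ Y′ ∣ * ∣ Z′ ∣) * (∣ xₙ ∣ ^ suc n * ∣ yₙ ∣ ^ suc n * ∣ zₙ ∣ ^ suc n)
    ≡⟨ interchange (∣ X′ ∣ * ∣ Y′ ∣) (∣ Z′ ∣) (∣ xₙ ∣ ^ suc n * ∣ yₙ ∣ ^ suc n) (∣ zₙ ∣ ^ suc n) ⟩
  (∣ X′ ∣ * ∣ Y′ ∣) * (∣ xₙ ∣ ^ suc n * ∣ yₙ ∣ ^ suc n) * (∣ Z′ ∣ * ∣ zₙ ∣ ^ suc n)
    ≡⟨ cong (_* (∣ Z′ ∣ * ∣ zₙ ∣ ^ suc n)) (interchange (∣ X′ ∣) (∣ Y′ ∣) (∣ xₙ ∣ ^ suc n) (∣ yₙ ∣ ^ suc n)) ⟩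
  (∣ X′ ∣ * ∣ xₙ ∣ ^ suc n) * (∣ Y′ ∣ * ∣ yₙ ∣ ^ suc n) * (∣ Z′ ∣ * ∣ zₙ ∣ ^ suc n)
    ≡⟨ sym (cong₂ _*_ (cong₂ _*_ (∣weightedProd-suc∣ n x) (∣weightedProd-suc∣ n y)) (∣weightedProd-suc∣ n z)) ⟩
  ∣ weightedProd (suc n) x ∣ * ∣ weightedProd (suc n) y ∣ * ∣ weightedProd (suc n) z ∣ ∎
  where
  open ≤-Reasoning
  x′ = x ∘ inject₁
  y′ = y ∘ inject₁
  z′ = z ∘ inject₁
  X′ = weightedProd n x′
  Y′ = weightedProd n y′
  Z′ = weightedProd n z′
  xₙ = x (fromℕ n)
  yₙ = y (fromℕ n)
  zₙ = z (fromℕ n)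
  init-bound : prodH n x′ y′ z′ ≤ ∣ X′ ∣ * ∣ Y′ ∣ * ∣ Z′ ∣
  init-bound = prodH≤∣weightedProd∣³ n x′ y′ z′
    {{weightedProd-init-nonZero x}} {{weightedProd-init-nonZero y}} {{weightedProd-init-nonZero z}}
  last-bound : H xₙ yₙ zₙ ≤ ∣ xₙ ∣ ^ suc n * ∣ yₙ ∣ ^ suc n * ∣ zₙ ∣ ^ suc n
  last-bound = H≤∣a∣^k*∣b∣^k*∣c∣^k (suc n) xₙ yₙ zₙ
    {{weightedProd-last-nonZero x}} {{weightedProd-last-nonZero y}} {{weightedProd-last-nonZero z}}

H*prodH≤H^4 : ∀ n (x y z : Fin n → ℤ) {a b c} →
  .{{_ : ℤ.NonZero a}} → .{{_ : ℤ.NonZero b}} → .{{_ : ℤ.NonZero c}} → RelPrime a b c →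
  weightedProd n x ≡ a → weightedProd n y ≡ b → weightedProd n z ≡ c →
  H a b c * prodH n x y z ≤ H a b c ^ 4
H*prodH≤H^4 n x y z {a} {b} {c} coprime refl refl refl = begin
  H a b c * prodH n x y z         ≡⟨ cong (_* prodH n x y z) H≡M ⟩
  M * prodH n x y z               ≤⟨ *-monoʳ-≤ M (prodH≤∣weightedProd∣³ n x y z) ⟩
  M * (∣ a ∣ * ∣ b ∣ * ∣ c ∣)     ≤⟨ *-monoʳ-≤ M (m*n*o≤[m⊔n⊔o]^3 (∣ a ∣) (∣ b ∣) (∣ c ∣)) ⟩
  M ^ 4                           ≡⟨ cong (_^ 4) (sym H≡M) ⟩
  H a b c ^ 4                     ∎
  where
  open ≤-Reasoning
  M = ∣ a ∣ ⊔ ∣ b ∣ ⊔ ∣ c ∣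
  H≡M : H a b c ≡ M
  H≡M = RelPrime⇒H≡∣a∣⊔∣b∣⊔∣c∣ {a} {b} {c} coprime

lemma3p11 : (n : ℕ) → .{{_ : NonZero n}} →
    ∃ λ (C : ℕ) →
      (a b c : ℤ) → ¬ (a ≡ 0ℤ) → ¬ (b ≡ 0ℤ) → ¬ (c ≡ 0ℤ) →
      RelPrime a b c → a + b + c ≡ 0ℤ →
      (x y z : Fin n → ℤ) →
      Admissible n a x → Admissible n b y → Admissible n c z →
      H a b c * prodH n x y z ≤ C * H a b c ^ 4
lemma3p11 n = 1 , λ where
  a b c a≢0 b≢0 c≢0 coprime _ x y z (x-prod , _) (y-prod , _) (z-prod , _) →
    ≤-trans (H*prodH≤H^4 n x y z {{ℤ.≢-nonZero a≢0}} {{ℤ.≢-nonZero b≢0}} {{ℤ.≢-nonZero c≢0}}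
                         coprime x-prod y-prod z-prod)
            (≤-reflexive (sym (*-identityˡ (H a b c ^ 4))))
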